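{- Let $j$ be a nonnegative integer. Then \[\sum_{n\ge0}\Big(\sum_{m\ge j}M(m,n)\Big)q^n=\frac{1}{(q)_\infty}\sum_{k=0}^\infty q^{j(2k+1)+k(2k+1)}\bigl(1-q^{2k+j+1}\bigr).\]
   Context: Write $(q)_\infty=\prod_{i\ge1}(1-q^i)$. $M(m,n)$ denotes the number of partitions of $n$ with crank $m$. In the convention used here, it is defined for integers $m$ and $n\ge0$ by Garvan's generating function \[\sum_{n\ge0}M(m,n)q^n=\frac{1}{(q)_\infty}\sum_{r\ge1}(-1)^{r-1}q^{r(r-1)/2+r|m|}(1-q^r).\] This agrees with the combinatorial crank count except at $n=1$. -}

module Defs where

open import Data.Bool using (if_then_else_)
open import Data.Nat as ℕ using (ℕ; zero; suc; _≡ᵇ_; _%_)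
open import Data.Integer as ℤ using (ℤ; +_; -_; ∣_∣)

-- Formal power series in q with integer coefficients: coefficient functions.
Series : Set
Series = ℕ → ℤ

sumTo : (ℕ → ℤ) → ℕ → ℤ
sumTo f zero    = + 0
sumTo f (suc n) = sumTo f n ℤ.+ f n

_*ₛ_ : Series → Series → Series
(f *ₛ g) n = sumTo (λ i → f i ℤ.* g (n ℕ.∸ i)) (suc n)

qpow : ℕ → Series
qpow e n = if e ≡ᵇ n then + 1 else + 0

-- The series 1/(1 - q^(k+1)) = Σ_{t ≥ 0} q^{(k+1) t}.
geomInv : ℕ → Series
geomInv k n = if (n % suc k) ≡ᵇ 0 then + 1 else + 0

invPochTrunc : ℕ → Series
invPochTrunc zero    = qpow 0
invPochTrunc (suc N) = invPochTrunc N *ₛ geomInv N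

-- 1/(q)_∞ = Π_{i ≥ 1} 1/(1 - q^i).  The coefficient of q^n only depends on
-- the factors with i ≤ n (the others are 1 + O(q^(n+1))).
invPoch : Series
invPoch n = invPochTrunc n n

-- triangular numbers: tri r = r (r - 1) / 2
tri : ℕ → ℕ
tri zero    = 0
tri (suc r) = tri r ℕ.+ r

alt : ℕ → ℤ
alt zero    = + 1
alt (suc k) = - alt k

-- Σ_{r ≥ 1} (-1)^(r-1) q^{r(r-1)/2 + r|m|} (1 - q^r).
-- The r-th term (r = k + 1) has order ≥ r - 1 = k, so the coefficient of q^n
-- only receives contributions from k ≤ n.
crankNum : ℤ → Series
crankNum m n = sumTo term (suc n)
  where
  term : ℕ → ℤ
  term k = alt k ℤ.* (qpow e n ℤ.- qpow (e ℕ.+ suc k) n)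
    where
    e : ℕ
    e = tri (suc k) ℕ.+ suc k ℕ.* ∣ m ∣

-- Garvan's crank count M(m,n), via its generating function.
M : ℤ → ℕ → ℤ
M m n = (invPoch *ₛ crankNum m) n

-- Σ_{k ≥ 0} q^{j(2k+1) + k(2k+1)} (1 - q^{2k+j+1}).
-- The k-th term has order ≥ k, so only k ≤ n contributes to q^n.
lemma3Num : ℕ → Series
lemma3Num j n = sumTo term (suc n)
  where
  term : ℕ → ℤ
  term k = qpow e n ℤ.- qpow (e ℕ.+ (2 ℕ.* k ℕ.+ j ℕ.+ 1)) n
    where
    e : ℕ
    e = j ℕ.* (2 ℕ.* k ℕ.+ 1) ℕ.+ k ℕ.* (2 ℕ.* k ℕ.+ 1)

{-# OPTIONS --safe #-}
-- Sum the crank generating function over m = j, j+1, ... and exchange the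
-- finite sums.  For fixed r the exponent r(r-1)/2 + r m grows by r with m,
-- so the terms q^{…} (1 - q^r) telescope in m, leaving Σ_r (-1)^{r-1} q^{r(r-1)/2 + r j}.
-- Pairing the terms r = 2k+1 and r = 2k+2 gives the k-th term of the
-- right-hand side, since (2k+1)(2k)/2 = k(2k+1).
module Submission where

open import Defs
open import Data.Nat using (ℕ; _≤_; _+_)
open import Data.Integer using (+_)
open import Data.Product using (∃-syntax)
open import Relation.Binary.PropositionalEquality using (_≡_)

open import Data.Nat as ℕ using (zero; suc; _<_; _∸_; s≤s)
import Data.Nat.Properties as ℕₚ
import Data.Nat.Tactic.RingSolver as ℕ-Solver
open import Data.Integer as ℤ using (ℤ)
import Data.Integer.Properties as ℤₚ
open import Data.Integer.Tactic.RingSolver using (solve-∀)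
open import Data.Bool using (true; false; T)
open import Data.Empty using (⊥-elim)
open import Data.Product using (_,_)
open import Relation.Binary.PropositionalEquality
  using (refl; sym; trans; cong; cong₂; subst; module ≡-Reasoning)

sumTo-cong : ∀ {f g : ℕ → ℤ} n → (∀ i → i < n → f i ≡ g i) → sumTo f n ≡ sumTo g n
sumTo-cong zero    f≗g = refl
sumTo-cong (suc n) f≗g =
  cong₂ ℤ._+_ (sumTo-cong n (λ i i<n → f≗g i (ℕₚ.m<n⇒m<1+n i<n))) (f≗g n ℕₚ.≤-refl)

sumTo-zero : ∀ n → sumTo (λ _ → + 0) n ≡ + 0
sumTo-zero zero    = refl
sumTo-zero (suc n) = cong (ℤ._+ + 0) (sumTo-zero n)

sumTo-+ : ∀ (f g : ℕ → ℤ) n → sumTo (λ i → f i ℤ.+ g i) n ≡ sumTo f n ℤ.+ sumTo g n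
sumTo-+ f g zero    = refl
sumTo-+ f g (suc n) =
  trans (cong (ℤ._+ (f n ℤ.+ g n)) (sumTo-+ f g n)) (interchange (sumTo f n) (sumTo g n) (f n) (g n))
  where
  interchange : ∀ a b c d → (a ℤ.+ b) ℤ.+ (c ℤ.+ d) ≡ (a ℤ.+ c) ℤ.+ (b ℤ.+ d)
  interchange = solve-∀

sumTo-*ˡ : ∀ c (f : ℕ → ℤ) n → sumTo (λ i → c ℤ.* f i) n ≡ c ℤ.* sumTo f n
sumTo-*ˡ c f zero    = sym (ℤₚ.*-zeroʳ c)
sumTo-*ˡ c f (suc n) =
  trans (cong (ℤ._+ c ℤ.* f n) (sumTo-*ˡ c f n)) (sym (ℤₚ.*-distribˡ-+ c (sumTo f n) (f n)))

sumTo-comm : ∀ (h : ℕ → ℕ → ℤ) a b →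
  sumTo (λ i → sumTo (h i) b) a ≡ sumTo (λ k → sumTo (λ i → h i k) a) b
sumTo-comm h zero    b = sym (sumTo-zero b)
sumTo-comm h (suc a) b =
  trans (cong (ℤ._+ sumTo (h a) b) (sumTo-comm h a b))
        (sym (sumTo-+ (λ k → sumTo (λ i → h i k) a) (h a) b))

sumTo-telescope : ∀ (a : ℕ → ℤ) n → sumTo (λ i → a i ℤ.- a (suc i)) n ≡ a 0 ℤ.- a n
sumTo-telescope a zero    = sym (ℤₚ.+-inverseʳ (a 0))
sumTo-telescope a (suc n) =
  trans (cong (ℤ._+ (a n ℤ.- a (suc n))) (sumTo-telescope a n)) (cancel (a 0) (a n) (a (suc n)))
  where
  cancel : ∀ x y z → (x ℤ.- y) ℤ.+ (y ℤ.- z) ≡ x ℤ.- z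
  cancel = solve-∀

sumTo-vanishing-tail : ∀ (f : ℕ → ℤ) a d → (∀ i → a ≤ i → f i ≡ + 0) → sumTo f (d + a) ≡ sumTo f a
sumTo-vanishing-tail f a zero    f≡0 = refl
sumTo-vanishing-tail f a (suc d) f≡0 =
  trans (cong₂ ℤ._+_ (sumTo-vanishing-tail f a d f≡0) (f≡0 (d + a) (ℕₚ.m≤n+m a d))) (ℤₚ.+-identityʳ _)

alt-even : ∀ k → alt (k + k) ≡ + 1
alt-even zero    = refl
alt-even (suc k) rewrite ℕₚ.+-suc k k = trans (ℤₚ.neg-involutive (alt (k + k))) (alt-even k)

sumTo-alt-pairs : ∀ (g : ℕ → ℤ) n →
  sumTo (λ k → alt k ℤ.* g k) (n + n) ≡ sumTo (λ k → g (k + k) ℤ.- g (suc (k + k))) n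
sumTo-alt-pairs g zero    = refl
sumTo-alt-pairs g (suc n) rewrite ℕₚ.+-suc n n | alt-even n | sumTo-alt-pairs g n =
  pair (sumTo (λ k → g (k + k) ℤ.- g (suc (k + k))) n) (g (n + n)) (g (suc (n + n)))
  where
  pair : ∀ s x y → (s ℤ.+ + 1 ℤ.* x) ℤ.+ ℤ.- + 1 ℤ.* y ≡ s ℤ.+ (x ℤ.- y)
  pair = solve-∀

*ₛ-sumToʳ : ∀ (f : Series) (g : ℕ → Series) N n →
  sumTo (λ i → (f *ₛ g i) n) N ≡ (f *ₛ (λ t → sumTo (λ i → g i t) N)) n
*ₛ-sumToʳ f g N n =
  trans (sumTo-comm (λ i a → f a ℤ.* g i (n ∸ a)) N (suc n))
        (sumTo-cong (suc n) (λ a _ → sumTo-*ˡ (f a) (λ i → g i (n ∸ a)) N))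

*ₛ-congʳ-≤ : ∀ (f : Series) {g h : Series} n → (∀ t → t ≤ n → g t ≡ h t) → (f *ₛ g) n ≡ (f *ₛ h) n
*ₛ-congʳ-≤ f n g≗h = sumTo-cong (suc n) (λ a _ → cong (f a ℤ.*_) (g≗h (n ∸ a) (ℕₚ.m∸n≤m n a)))

qpow-< : ∀ {t e} → t < e → qpow e t ≡ + 0
qpow-< {t} {e} t<e with e ℕ.≡ᵇ t in e≡ᵇt
... | false = refl
... | true  = ⊥-elim (ℕₚ.<⇒≢ t<e (sym (ℕₚ.≡ᵇ⇒≡ e t (subst T (sym e≡ᵇt) _))))

-- The exponent r(r-1)/2 + r m of the r-th crank term, indexed by k = r - 1.
crankExp : ℕ → ℕ → ℕ
crankExp k m = tri (suc k) + suc k ℕ.* m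

crankExp-suc : ∀ k m → crankExp k m + suc k ≡ crankExp k (suc m)
crankExp-suc k m = shift (tri (suc k)) k m
  where
  shift : ∀ a k m → a + suc k ℕ.* m + suc k ≡ a + suc k ℕ.* suc m
  shift = ℕ-Solver.solve-∀

m≤crankExp : ∀ k m → m ≤ crankExp k m
m≤crankExp k m = ℕₚ.≤-trans (ℕₚ.m≤m+n m (k ℕ.* m)) (ℕₚ.m≤n+m (suc k ℕ.* m) (tri (suc k)))

k≤crankExp : ∀ k m → k ≤ crankExp k m
k≤crankExp k m = ℕₚ.≤-trans (ℕₚ.m≤n+m k (tri k)) (ℕₚ.m≤m+n (tri (suc k)) (suc k ℕ.* m))

tri-odd : ∀ k → tri (suc (k + k)) ≡ k ℕ.* (2 ℕ.* k ℕ.+ 1)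
tri-odd zero    = refl
tri-odd (suc k) rewrite ℕₚ.+-suc k k | tri-odd k = step k
  where
  step : ∀ k → k ℕ.* (2 ℕ.* k ℕ.+ 1) + suc (k + k) + suc (suc (k + k)) ≡ suc k ℕ.* (2 ℕ.* suc k ℕ.+ 1)
  step = ℕ-Solver.solve-∀

crankExp-even : ∀ j k → crankExp (k + k) j ≡ j ℕ.* (2 ℕ.* k ℕ.+ 1) + k ℕ.* (2 ℕ.* k ℕ.+ 1)
crankExp-even j k rewrite tri-odd k = ring j k
  where
  ring : ∀ j k → k ℕ.* (2 ℕ.* k ℕ.+ 1) + suc (k + k) ℕ.* j ≡ j ℕ.* (2 ℕ.* k ℕ.+ 1) + k ℕ.* (2 ℕ.* k ℕ.+ 1)
  ring = ℕ-Solver.solve-∀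

crankExp-odd : ∀ j k →
  crankExp (suc (k + k)) j ≡ j ℕ.* (2 ℕ.* k ℕ.+ 1) + k ℕ.* (2 ℕ.* k ℕ.+ 1) + (2 ℕ.* k ℕ.+ j ℕ.+ 1)
crankExp-odd j k rewrite tri-odd k = ring j k
  where
  ring : ∀ j k → k ℕ.* (2 ℕ.* k ℕ.+ 1) + suc (k + k) + suc (suc (k + k)) ℕ.* j
                 ≡ j ℕ.* (2 ℕ.* k ℕ.+ 1) + k ℕ.* (2 ℕ.* k ℕ.+ 1) + (2 ℕ.* k ℕ.+ j ℕ.+ 1)
  ring = ℕ-Solver.solve-∀

crankNum-differences : ∀ m t → crankNum (+ m) t
  ≡ sumTo (λ k → alt k ℤ.* (qpow (crankExp k m) t ℤ.- qpow (crankExp k (suc m)) t)) (suc t)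
crankNum-differences m t =
  sumTo-cong (suc t) (λ k _ → cong (λ e → alt k ℤ.* (qpow (crankExp k m) t ℤ.- qpow e t)) (crankExp-suc k m))

crankExp-telescope : ∀ j k {t N} → t < N →
  sumTo (λ i → qpow (crankExp k (j + i)) t ℤ.- qpow (crankExp k (suc (j + i))) t) N ≡ qpow (crankExp k j) t
crankExp-telescope j k {t} {N} t<N = begin
    sumTo (λ i → a i ℤ.- qpow (crankExp k (suc (j + i))) t) N
  ≡⟨ sumTo-cong N (λ i _ → cong (λ m → a i ℤ.- qpow (crankExp k m) t) (sym (ℕₚ.+-suc j i))) ⟩
    sumTo (λ i → a i ℤ.- a (suc i)) N
  ≡⟨ sumTo-telescope a N ⟩
    a 0 ℤ.- a N
  ≡⟨ cong₂ ℤ._-_ (cong (λ m → qpow (crankExp k m) t) (ℕₚ.+-identityʳ j)) (qpow-< t<crankExp) ⟩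
    qpow (crankExp k j) t ℤ.+ ℤ.- + 0
  ≡⟨ ℤₚ.+-identityʳ _ ⟩
    qpow (crankExp k j) t
  ∎
  where
  open ≡-Reasoning
  a : ℕ → ℤ
  a i = qpow (crankExp k (j + i)) t
  t<crankExp : t < crankExp k (j + N)
  t<crankExp = ℕₚ.<-≤-trans t<N (ℕₚ.≤-trans (ℕₚ.m≤n+m N j) (m≤crankExp k (j + N)))

crankNum-tail-sum : ∀ j {t N} → t < N →
  sumTo (λ i → crankNum (+ (j + i)) t) N ≡ sumTo (λ k → alt k ℤ.* qpow (crankExp k j) t) (suc t)
crankNum-tail-sum j {t} {N} t<N = begin
    sumTo (λ i → crankNum (+ (j + i)) t) N
  ≡⟨ sumTo-cong N (λ i _ → crankNum-differences (j + i) t) ⟩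
    sumTo (λ i → sumTo (λ k → alt k ℤ.* difference k i) (suc t)) N
  ≡⟨ sumTo-comm (λ i k → alt k ℤ.* difference k i) N (suc t) ⟩
    sumTo (λ k → sumTo (λ i → alt k ℤ.* difference k i) N) (suc t)
  ≡⟨ sumTo-cong (suc t) (λ k _ →
       trans (sumTo-*ˡ (alt k) (difference k) N) (cong (alt k ℤ.*_) (crankExp-telescope j k t<N))) ⟩
    sumTo (λ k → alt k ℤ.* qpow (crankExp k j) t) (suc t)
  ∎
  where
  open ≡-Reasoning
  difference : ℕ → ℕ → ℤ
  difference k i = qpow (crankExp k (j + i)) t ℤ.- qpow (crankExp k (suc (j + i))) t

alternating-crank-pairs : ∀ j t → sumTo (λ k → alt k ℤ.* qpow (crankExp k j) t) (suc t) ≡ lemma3Num j t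
alternating-crank-pairs j t = begin
    sumTo (λ k → alt k ℤ.* qpow (crankExp k j) t) (suc t)
  ≡⟨ sym (sumTo-vanishing-tail _ (suc t) (suc t) (λ k t<k →
       trans (cong (alt k ℤ.*_) (qpow-< (ℕₚ.<-≤-trans t<k (k≤crankExp k j)))) (ℤₚ.*-zeroʳ (alt k)))) ⟩
    sumTo (λ k → alt k ℤ.* qpow (crankExp k j) t) (suc t + suc t)
  ≡⟨ sumTo-alt-pairs (λ k → qpow (crankExp k j) t) (suc t) ⟩
    sumTo (λ k → qpow (crankExp (k + k) j) t ℤ.- qpow (crankExp (suc (k + k)) j) t) (suc t)
  ≡⟨ sumTo-cong (suc t) (λ k _ → cong₂ (λ e e′ → qpow e t ℤ.- qpow e′ t) (crankExp-even j k) (crankExp-odd j k)) ⟩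
    lemma3Num j t
  ∎
  where open ≡-Reasoning

lemma3 : (j n : ℕ) →
    ∃[ N ] ((N′ : ℕ) → N ≤ N′ →
      sumTo (λ i → M (+ (j + i)) n) N′ ≡ (invPoch *ₛ lemma3Num j) n)
lemma3 j n = suc n , λ N′ n<N′ → begin
    sumTo (λ i → M (+ (j + i)) n) N′
  ≡⟨ *ₛ-sumToʳ invPoch (λ i → crankNum (+ (j + i))) N′ n ⟩
    (invPoch *ₛ (λ t → sumTo (λ i → crankNum (+ (j + i)) t) N′)) n
  ≡⟨ *ₛ-congʳ-≤ invPoch n (λ t t≤n →
       trans (crankNum-tail-sum j (ℕₚ.<-≤-trans (s≤s t≤n) n<N′)) (alternating-crank-pairs j t)) ⟩
    (invPoch *ₛ lemma3Num j) n
  ∎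
  where open ≡-Reasoning
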